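{- Let $(\alpha_n,\beta_n)_{n\ge0}$ be a Bailey pair with parameters $(1,q)$ such that $\alpha_0=\beta_0=1$. Then for all positive integers $N$ and $k$, $$\sum_{N\ge n_k\ge\cdots\ge n_1\ge1}\frac{(q)_{n_1}^2q^{n_1+\cdots+n_k}\beta_{n_1}}{(1-q^{n_k})^2(1-q^{n_{k-1}})^2\cdots(1-q^{n_1})^2}=\sum_{N\ge n_k\ge\cdots\ge n_1\ge1}\frac{q^{n_1+\cdots+n_k}}{(1-q^{n_k})^2\cdots(1-q^{n_1})^2}+\sum_{r=1}^{N}\frac{(q)_N^2}{(q)_{N-r}(q)_{N+r}}\frac{q^{kr}\alpha_r}{(1-q^r)^{2k}}.$$
   Context: $(a)_n=(a;q)_n=\prod_{i=0}^{n-1}(1-aq^i)$, $(a)_0=1$. A pair of sequences $(\alpha_n,\beta_n)_{n\ge 0}$ (of functions of $q$, e.g. formal power series or rational functions) is a Bailey pair with parameters $(a,q)$ if for each nonnegative integer $n$, $\beta_n=\sum_{r=0}^{n}\frac{\alpha_r}{(q;q)_{n-r}(aq;q)_{n+r}}$. -}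

module Defs where

open import Level using (Level; _⊔_) renaming (suc to lsuc)
open import Data.Nat using (ℕ; zero; suc) renaming (_+_ to _+ℕ_; _∸_ to _∸ℕ_)
open import Data.Vec using (Vec; []; _∷_)
open import Relation.Nullary using (¬_)
open import Algebra.Bundles using (CommutativeRing)

record Field (c ℓ : Level) : Set (lsuc (c ⊔ ℓ)) where
  field
    commutativeRing : CommutativeRing c ℓ
  open CommutativeRing commutativeRing public
  field
    _⁻¹       : Carrier → Carrier
    1≉0       : ¬ (1# ≈ 0#)
    ⁻¹-inverse : ∀ x → ¬ (x ≈ 0#) → x * (x ⁻¹) ≈ 1#

module FieldOps {c ℓ : Level} (F : Field c ℓ) where
  open Field F

  infixl 7 _/_
  _/_ : Carrier → Carrier → Carrier
  x / y = x * (y ⁻¹)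

  pow : Carrier → ℕ → Carrier
  pow x zero    = 1#
  pow x (suc n) = x * pow x n

  qPoch : Carrier → Carrier → ℕ → Carrier
  qPoch a q zero    = 1#
  qPoch a q (suc n) = qPoch a q n * (1# - a * pow q n)

  sum0 : ℕ → (ℕ → Carrier) → Carrier
  sum0 zero    f = f 0
  sum0 (suc n) f = sum0 n f + f (suc n)

  sum1 : ℕ → (ℕ → Carrier) → Carrier
  sum1 zero    f = 0#
  sum1 (suc n) f = sum1 n f + f (suc n)

  IsBaileyPair : Carrier → Carrier → (ℕ → Carrier) → (ℕ → Carrier) → Set ℓ
  IsBaileyPair a q α β =
    ∀ n → β n ≈ sum0 n (λ r → α r / (qPoch q q (n ∸ℕ r) * qPoch (a * q) q (n +ℕ r)))

  -- chainSum k N G = ∑ over all (n_k, …, n_1) with N ≥ n_k ≥ ⋯ ≥ n_1 ≥ 1 of G,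
  -- where the vector is listed as n_k ∷ n_{k-1} ∷ ⋯ ∷ n_1 ∷ [].
  chainSum : (k : ℕ) → ℕ → (Vec ℕ k → Carrier) → Carrier
  chainSum zero    N G = G []
  chainSum (suc k) N G = sum1 N (λ m → chainSum k m (λ v → G (m ∷ v)))

  vsum : {k : ℕ} → Vec ℕ k → ℕ
  vsum []       = 0
  vsum (n ∷ ns) = n +ℕ vsum ns

  sqDen : Carrier → {k : ℕ} → Vec ℕ k → Carrier
  sqDen q []       = 1#
  sqDen q (n ∷ ns) = (1# - pow q n) * (1# - pow q n) * sqDen q ns

  -- the last entry of the vector (this is n_1); 0 for the empty vector (unused: k ≥ 1)
  lastOr0 : {k : ℕ} → Vec ℕ k → ℕ
  lastOr0 []           = 0
  lastOr0 (n ∷ [])     = n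
  lastOr0 (n ∷ m ∷ ns) = lastOr0 (m ∷ ns)

{-# OPTIONS --safe #-}
-- Write cₙ = qⁿ/(1 - qⁿ)². The left side is a k-fold nested sum of hₙ₁ cₙ₁ ⋯ cₙₖ with hₙ = (q)ₙ² βₙ, and the
-- Bailey relation expands hₙ = Σᵣ αᵣ Fᵣ(n) with Fᵣ(n) = (q)ₙ² / ((q)ₙ₋ᵣ (q)ₙ₊ᵣ). For r ≥ 1 the kernel telescopes,
-- Σ_{1 ≤ n ≤ N} cₙ Fᵣ(n) = cᵣ Fᵣ(N), because Fᵣ(n+1)/Fᵣ(n) = (1 - qⁿ⁺¹)² / ((1 - qⁿ⁻ʳ⁺¹)(1 - qⁿ⁺ʳ⁺¹)); so each
-- nesting level contributes a factor cᵣ, giving the r-th term on the right. For r = 0 the kernel is 1, which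
-- gives the first sum on the right.
module Submission where

open import Defs
open import Level using (Level)
open import Data.Nat using (ℕ; zero; suc; _≤_; _<_; _≤′_; _≤?_; z≤n; s≤s; ≤′-reflexive; ≤′-step) renaming (_*_ to _*ℕ_; _∸_ to _∸ℕ_; _+_ to _+ℕ_)
open import Data.Nat.Properties as ℕₚ using (≤⇒≤′; ≤′⇒≤; m≤n⇒m<n∨m≡n; m+n∸n≡m; m∸n+n≡m; m≤n+m; m≤n⇒m≤1+n; ≤-trans; ≤-refl)
open import Data.Maybe using (nothing)
open import Data.Sum using (inj₁; inj₂)
open import Data.Vec using (Vec; []; _∷_)
open import Data.Vec.Relation.Unary.All using (All; []; _∷_)
open import Relation.Nullary using (¬_; yes; no; contradiction)
open import Relation.Binary.PropositionalEquality as ≡ using (_≡_)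

module FieldProperties {c ℓ : Level} (F : Field c ℓ) where
  open Field F
  open FieldOps F
  open import Relation.Binary.Reasoning.Setoid setoid
  open import Algebra.Properties.Ring ring using (-1*x≈-x)
  open import Algebra.Properties.CommutativeSemigroup *-commutativeSemigroup using (interchange)
  open import Algebra.Properties.CommutativeSemiring.Exp commutativeSemiring using (_^_; ^-homo-*; ^-assocʳ; ^-distrib-*)
  open import Algebra.Solver.Ring.NaturalCoefficients commutativeSemiring (λ _ _ → nothing)

  NonZero : Carrier → Set ℓ
  NonZero x = ¬ (x ≈ 0#)

  *-⁻¹-cancelˡ : ∀ {x} y → NonZero x → x * y * x ⁻¹ ≈ y
  *-⁻¹-cancelˡ {x} y x≉0 = begin
    x * y * x ⁻¹   ≈⟨ *-congʳ (*-comm x y) ⟩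
    y * x * x ⁻¹   ≈⟨ *-assoc y x (x ⁻¹) ⟩
    y * (x * x ⁻¹) ≈⟨ *-congˡ (⁻¹-inverse x x≉0) ⟩
    y * 1#         ≈⟨ *-identityʳ y ⟩
    y              ∎

  *-nonZero : ∀ {x y} → NonZero x → NonZero y → NonZero (x * y)
  *-nonZero {x} {y} x≉0 y≉0 xy≈0 = y≉0 (begin
    y            ≈⟨ *-⁻¹-cancelˡ y x≉0 ⟨
    x * y * x ⁻¹ ≈⟨ *-congʳ xy≈0 ⟩
    0# * x ⁻¹    ≈⟨ zeroˡ (x ⁻¹) ⟩
    0#           ∎)

  ⁻¹-unique : ∀ {x y} → NonZero x → x * y ≈ 1# → y ≈ x ⁻¹
  ⁻¹-unique {x} {y} x≉0 xy≈1 = begin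
    y            ≈⟨ *-⁻¹-cancelˡ y x≉0 ⟨
    x * y * x ⁻¹ ≈⟨ *-congʳ xy≈1 ⟩
    1# * x ⁻¹    ≈⟨ *-identityˡ (x ⁻¹) ⟩
    x ⁻¹         ∎

  ⁻¹-cong : ∀ {x y} → NonZero x → x ≈ y → x ⁻¹ ≈ y ⁻¹
  ⁻¹-cong {x} x≉0 x≈y =
    ⁻¹-unique (λ y≈0 → x≉0 (trans x≈y y≈0)) (trans (*-congʳ (sym x≈y)) (⁻¹-inverse x x≉0))

  ⁻¹-distrib-* : ∀ {x y} → NonZero x → NonZero y → (x * y) ⁻¹ ≈ x ⁻¹ * y ⁻¹
  ⁻¹-distrib-* {x} {y} x≉0 y≉0 = sym (⁻¹-unique (*-nonZero x≉0 y≉0) (begin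
    x * y * (x ⁻¹ * y ⁻¹)   ≈⟨ interchange x y (x ⁻¹) (y ⁻¹) ⟩
    x * x ⁻¹ * (y * y ⁻¹)   ≈⟨ *-cong (⁻¹-inverse x x≉0) (⁻¹-inverse y y≉0) ⟩
    1# * 1#                 ≈⟨ *-identityˡ 1# ⟩
    1#                      ∎))

  1⁻¹≈1 : 1# ⁻¹ ≈ 1#
  1⁻¹≈1 = sym (⁻¹-unique 1≉0 (*-identityˡ 1#))

  pow≡^ : ∀ x n → pow x n ≡ x ^ n
  pow≡^ x zero    = ≡.refl
  pow≡^ x (suc n) = ≡.cong (x *_) (pow≡^ x n)

  pow-homo-* : ∀ x m n → pow x (m +ℕ n) ≈ pow x m * pow x n
  pow-homo-* x m n rewrite pow≡^ x (m +ℕ n) | pow≡^ x m | pow≡^ x n = ^-homo-* x m n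

  pow-assocʳ : ∀ x m n → pow (pow x m) n ≈ pow x (m *ℕ n)
  pow-assocʳ x m n rewrite pow≡^ (pow x m) n | pow≡^ x m | pow≡^ x (m *ℕ n) = ^-assocʳ x m n

  pow-distrib-* : ∀ x y n → pow (x * y) n ≈ pow x n * pow y n
  pow-distrib-* x y n rewrite pow≡^ (x * y) n | pow≡^ x n | pow≡^ y n = ^-distrib-* x y n

  pow-nonZero : ∀ {x} n → NonZero x → NonZero (pow x n)
  pow-nonZero zero    x≉0 = 1≉0
  pow-nonZero (suc n) x≉0 = *-nonZero x≉0 (pow-nonZero n x≉0)

  pow-⁻¹ : ∀ {x} n → NonZero x → pow (x ⁻¹) n ≈ pow x n ⁻¹
  pow-⁻¹ zero        x≉0 = sym 1⁻¹≈1
  pow-⁻¹ {x} (suc n) x≉0 = begin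
    x ⁻¹ * pow (x ⁻¹) n   ≈⟨ *-congˡ (pow-⁻¹ n x≉0) ⟩
    x ⁻¹ * pow x n ⁻¹     ≈⟨ ⁻¹-distrib-* x≉0 (pow-nonZero n x≉0) ⟨
    (x * pow x n) ⁻¹      ∎

  pow-/ : ∀ x {y} n → NonZero y → pow (x / y) n ≈ pow x n / pow y n
  pow-/ x {y} n y≉0 = trans (pow-distrib-* x (y ⁻¹) n) (*-congˡ (pow-⁻¹ n y≉0))

  pow-square : ∀ x n → pow (x * x) n ≈ pow x (2 *ℕ n)
  pow-square x n = begin
    pow (x * x) n         ≈⟨ pow-distrib-* x x n ⟩
    pow x n * pow x n     ≈⟨ pow-homo-* x n n ⟨
    pow x (n +ℕ n)        ≡⟨ ≡.cong (λ m → pow x (n +ℕ m)) (ℕₚ.+-identityʳ n) ⟨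
    pow x (2 *ℕ n)        ∎

  -- Proved as a semiring identity in x, y and m = -1: the two sides differ by x y (1 + m)(1 + m y²).
  telescoping-polynomial : ∀ {x y z w} → z ≈ x * y → w ≈ x * y * y →
    y * ((1# - x) * (1# - w)) + z * ((1# - y) * (1# - y)) ≈ y * ((1# - z) * (1# - z))
  telescoping-polynomial {x} {y} {z} {w} z≈xy w≈xyy = begin
    y * ((1# - x) * (1# - w)) + z * ((1# - y) * (1# - y))
      ≈⟨ +-cong (*-congˡ (*-cong (1-≈ refl) (1-≈ w≈xyy))) (*-cong z≈xy (*-cong (1-≈ refl) (1-≈ refl))) ⟩
    y * ((1# + m * x) * (1# + m * (x * y * y))) + x * y * ((1# + m * y) * (1# + m * y))
      ≈⟨ solve 3 (λ x y m → y :* ((con 1 :+ m :* x) :* (con 1 :+ m :* (x :* y :* y)))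
                              :+ x :* y :* ((con 1 :+ m :* y) :* (con 1 :+ m :* y))
                          := y :* ((con 1 :+ m :* (x :* y)) :* (con 1 :+ m :* (x :* y)))
                              :+ x :* y :* ((con 1 :+ m) :* (con 1 :+ m :* y :* y))) refl x y m ⟩
    y * ((1# + m * (x * y)) * (1# + m * (x * y))) + x * y * ((1# + m) * (1# + m * y * y))
      ≈⟨ +-congˡ (*-congˡ (trans (*-congʳ (-‿inverseʳ 1#)) (zeroˡ _))) ⟩
    y * ((1# + m * (x * y)) * (1# + m * (x * y))) + x * y * 0#
      ≈⟨ trans (+-congˡ (zeroʳ _)) (+-identityʳ _) ⟩
    y * ((1# + m * (x * y)) * (1# + m * (x * y)))
      ≈⟨ *-congˡ (*-cong (1-≈ z≈xy) (1-≈ z≈xy)) ⟨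
    y * ((1# - z) * (1# - z)) ∎
    where
    m : Carrier
    m = - 1#
    1-≈ : ∀ {t u} → t ≈ u → 1# - t ≈ 1# + m * u
    1-≈ {u = u} t≈u = +-congˡ (trans (-‿cong t≈u) (sym (-1*x≈-x u)))

  telescoping-fraction : ∀ {σ α β} y z K → NonZero σ → NonZero α → NonZero β →
    y * β + z * σ ≈ y * α → y / σ * K + z / α * (K * α / β) ≈ y / σ * (K * α / β)
  telescoping-fraction {σ} {α} {β} y z K σ≉0 α≉0 β≉0 eq = begin
    y / σ * K + z / α * (K * α / β)
      ≈⟨ solve 7 (λ y z K α i j l → y :* i :* K :+ z :* j :* (K :* α :* l)
                                  := y :* i :* K :* con 1 :+ z :* K :* l :* (α :* j))
                 refl y z K α (σ ⁻¹) (α ⁻¹) (β ⁻¹) ⟩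
    y / σ * K * 1# + z * K / β * (α * α ⁻¹)
      ≈⟨ +-cong (*-congˡ (sym (⁻¹-inverse β β≉0))) (*-congˡ (⁻¹-inverse α α≉0)) ⟩
    y / σ * K * (β * β ⁻¹) + z * K / β * 1#
      ≈⟨ +-congˡ (*-congˡ (⁻¹-inverse σ σ≉0)) ⟨
    y / σ * K * (β * β ⁻¹) + z * K / β * (σ * σ ⁻¹)
      ≈⟨ solve 7 (λ y z K σ β i l → y :* i :* K :* (β :* l) :+ z :* K :* l :* (σ :* i)
                                  := K :* i :* l :* (y :* β :+ z :* σ))
                 refl y z K σ β (σ ⁻¹) (β ⁻¹) ⟩
    K / σ / β * (y * β + z * σ)
      ≈⟨ *-congˡ eq ⟩
    K / σ / β * (y * α)
      ≈⟨ solve 5 (λ y K α i l → K :* i :* l :* (y :* α) := y :* i :* (K :* α :* l)) refl y K α (σ ⁻¹) (β ⁻¹) ⟩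
    y / σ * (K * α / β) ∎

module SumProperties {c ℓ : Level} (F : Field c ℓ) where
  open Field F
  open FieldOps F
  open import Algebra.Properties.CommutativeSemigroup +-commutativeSemigroup using (interchange)

  sum0-cong : ∀ N {f g : ℕ → Carrier} → (∀ m → m ≤ N → f m ≈ g m) → sum0 N f ≈ sum0 N g
  sum0-cong zero    f≈g = f≈g 0 z≤n
  sum0-cong (suc N) f≈g =
    +-cong (sum0-cong N (λ m m≤N → f≈g m (m≤n⇒m≤1+n m≤N))) (f≈g (suc N) ≤-refl)

  sum1-cong : ∀ N {f g : ℕ → Carrier} → (∀ m → 1 ≤ m → m ≤ N → f m ≈ g m) → sum1 N f ≈ sum1 N g
  sum1-cong zero    f≈g = refl
  sum1-cong (suc N) f≈g =
    +-cong (sum1-cong N (λ m 1≤m m≤N → f≈g m 1≤m (m≤n⇒m≤1+n m≤N))) (f≈g (suc N) (s≤s z≤n) ≤-refl)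

  sum0-*ˡ : ∀ N a f → a * sum0 N f ≈ sum0 N (λ m → a * f m)
  sum0-*ˡ zero    a f = refl
  sum0-*ˡ (suc N) a f = trans (distribˡ a _ _) (+-congʳ (sum0-*ˡ N a f))

  sum1-*ˡ : ∀ N a f → a * sum1 N f ≈ sum1 N (λ m → a * f m)
  sum1-*ˡ zero    a f = zeroʳ a
  sum1-*ˡ (suc N) a f = trans (distribˡ a _ _) (+-congʳ (sum1-*ˡ N a f))

  sum0-+ : ∀ N f g → sum0 N (λ m → f m + g m) ≈ sum0 N f + sum0 N g
  sum0-+ zero    f g = refl
  sum0-+ (suc N) f g = trans (+-congʳ (sum0-+ N f g)) (interchange _ _ _ _)

  sum0-zero : ∀ N → sum0 N (λ _ → 0#) ≈ 0#
  sum0-zero zero    = refl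
  sum0-zero (suc N) = trans (+-identityʳ _) (sum0-zero N)

  sum1-sum0-comm : ∀ N M (G : ℕ → ℕ → Carrier) →
    sum1 N (λ m → sum0 M (G m)) ≈ sum0 M (λ r → sum1 N (λ m → G m r))
  sum1-sum0-comm zero    M G = sym (sum0-zero M)
  sum1-sum0-comm (suc N) M G = trans (+-congʳ (sum1-sum0-comm N M G)) (sym (sum0-+ M _ _))

  sum0≈head+sum1 : ∀ N f → sum0 N f ≈ f 0 + sum1 N f
  sum0≈head+sum1 zero    f = sym (+-identityʳ _)
  sum0≈head+sum1 (suc N) f = trans (+-congʳ (sum0≈head+sum1 N f)) (+-assoc _ _ _)

  sum0-truncate : ∀ {n N} f → n ≤ N → (∀ r → n < r → f r ≈ 0#) → sum0 N f ≈ sum0 n f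
  sum0-truncate {n} f n≤N f≈0 = go (≤⇒≤′ n≤N)
    where
    go : ∀ {N} → n ≤′ N → sum0 N f ≈ sum0 n f
    go (≤′-reflexive ≡.refl) = refl
    go (≤′-step {N} n≤′N)    =
      trans (+-cong (go n≤′N) (f≈0 (suc N) (s≤s (≤′⇒≤ n≤′N)))) (+-identityʳ _)

module BaileyChain {c ℓ : Level} (F : Field c ℓ) where
  open Field F
  open FieldOps F
  open FieldProperties F

  module WithBase (q : Carrier) (1-q^suc≉0 : ∀ m → NonZero (1# - pow q (suc m))) where

    open SumProperties F
    open import Relation.Binary.Reasoning.Setoid setoid
    open import Algebra.Properties.CommutativeSemigroup *-commutativeSemigroup
      using (interchange; x∙yz≈y∙xz; x∙yz≈yx∙z)
    open import Algebra.Solver.Ring.NaturalCoefficients commutativeSemiring (λ _ _ → nothing)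

    poch : ℕ → Carrier
    poch n = qPoch q q n

    poch-nonZero : ∀ n → NonZero (poch n)
    poch-nonZero zero    = 1≉0
    poch-nonZero (suc n) = *-nonZero (poch-nonZero n) (1-q^suc≉0 n)

    qPoch-congˡ : ∀ {a b} n → a ≈ b → qPoch a q n ≈ qPoch b q n
    qPoch-congˡ zero    a≈b = refl
    qPoch-congˡ (suc n) a≈b = *-cong (qPoch-congˡ n a≈b) (+-congˡ (-‿cong (*-congʳ a≈b)))

    weight : ℕ → Carrier
    weight m = pow q m / ((1# - pow q m) * (1# - pow q m))

    chainWeight : ∀ {k} → Vec ℕ k → Carrier
    chainWeight v = pow q (vsum v) / sqDen q v

    sqDen-nonZero : ∀ {k} {v : Vec ℕ k} → All (1 ≤_) v → NonZero (sqDen q v)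
    sqDen-nonZero []                      = 1≉0
    sqDen-nonZero {v = suc n ∷ _} (_ ∷ v⁺) =
      *-nonZero (*-nonZero (1-q^suc≉0 n) (1-q^suc≉0 n)) (sqDen-nonZero v⁺)

    chainWeight-[] : chainWeight [] ≈ 1#
    chainWeight-[] = trans (*-identityˡ _) 1⁻¹≈1

    *-chainWeight-∷ : ∀ {k m} {v : Vec ℕ k} x → 1 ≤ m → All (1 ≤_) v →
      x * chainWeight (m ∷ v) ≈ weight m * (x * chainWeight v)
    *-chainWeight-∷ {m = suc m} {v} x _ v⁺ = trans (*-congˡ chainWeight-∷) (x∙yz≈y∙xz _ _ _)
      where
      s : Carrier
      s = 1# - pow q (suc m)
      chainWeight-∷ : chainWeight (suc m ∷ v) ≈ weight (suc m) * chainWeight v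
      chainWeight-∷ = begin
        pow q (suc m +ℕ vsum v) * (s * s * sqDen q v) ⁻¹
          ≈⟨ *-cong (pow-homo-* q (suc m) (vsum v))
                    (⁻¹-distrib-* (*-nonZero (1-q^suc≉0 m) (1-q^suc≉0 m)) (sqDen-nonZero v⁺)) ⟩
        pow q (suc m) * pow q (vsum v) * ((s * s) ⁻¹ * sqDen q v ⁻¹)
          ≈⟨ interchange _ _ _ _ ⟩
        weight (suc m) * chainWeight v ∎

    chainSum-cong : ∀ k N {G H : Vec ℕ k → Carrier} →
      (∀ v → All (1 ≤_) v → G v ≈ H v) → chainSum k N G ≈ chainSum k N H
    chainSum-cong zero    N G≈H = G≈H [] []
    chainSum-cong (suc k) N G≈H =
      sum1-cong N (λ m 1≤m _ → chainSum-cong k m (λ v v⁺ → G≈H (m ∷ v) (1≤m ∷ v⁺)))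

    chainSum-*ˡ : ∀ k N a G → a * chainSum k N G ≈ chainSum k N (λ v → a * G v)
    chainSum-*ˡ zero    N a G = refl
    chainSum-*ˡ (suc k) N a G =
      trans (sum1-*ˡ N a _) (sum1-cong N (λ m _ _ → chainSum-*ˡ k m a _))

    nestedSum : (ℕ → Carrier) → ℕ → ℕ → Carrier
    nestedSum h zero    N = h N
    nestedSum h (suc k) N = sum1 N (λ m → weight m * nestedSum h k m)

    chainSum≈nestedSum : ∀ k N h (G : Vec ℕ (suc k) → Carrier) →
      (∀ v → G v ≈ h (lastOr0 v) * chainWeight v) → chainSum (suc k) N G ≈ nestedSum h (suc k) N
    chainSum≈nestedSum zero N h G G≈ = sum1-cong N λ m 1≤m _ → begin
      G (m ∷ [])                          ≈⟨ G≈ (m ∷ []) ⟩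
      h m * chainWeight (m ∷ [])          ≈⟨ *-chainWeight-∷ (h m) 1≤m [] ⟩
      weight m * (h m * chainWeight [])   ≈⟨ *-congˡ (trans (*-congˡ chainWeight-[]) (*-identityʳ (h m))) ⟩
      weight m * h m                      ∎
    chainSum≈nestedSum (suc k) N h G G≈ = sum1-cong N λ m 1≤m _ → begin
      chainSum (suc k) m (λ v → G (m ∷ v))
        ≈⟨ chainSum-cong (suc k) m {G = λ v → G (m ∷ v)} {H = λ v → weight m * (h (lastOr0 v) * chainWeight v)}
             (λ { (x ∷ v) v⁺ → trans (G≈ (m ∷ x ∷ v)) (*-chainWeight-∷ _ 1≤m v⁺) }) ⟩
      chainSum (suc k) m (λ v → weight m * (h (lastOr0 v) * chainWeight v))
        ≈⟨ chainSum-*ˡ (suc k) m (weight m) (λ v → h (lastOr0 v) * chainWeight v) ⟨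
      weight m * chainSum (suc k) m (λ v → h (lastOr0 v) * chainWeight v)
        ≈⟨ *-congˡ (chainSum≈nestedSum k m h _ (λ _ → refl)) ⟩
      weight m * nestedSum h (suc k) m ∎

    nestedSum-cong : ∀ k N {h h′ : ℕ → Carrier} →
      (∀ n → n ≤ N → h n ≈ h′ n) → nestedSum h k N ≈ nestedSum h′ k N
    nestedSum-cong zero    N h≈h′ = h≈h′ N ≤-refl
    nestedSum-cong (suc k) N h≈h′ = sum1-cong N λ m _ m≤N →
      *-congˡ (nestedSum-cong k m (λ n n≤m → h≈h′ n (≤-trans n≤m m≤N)))

    nestedSum-*ˡ : ∀ k N a h → nestedSum (λ n → a * h n) k N ≈ a * nestedSum h k N
    nestedSum-*ˡ zero    N a h = refl
    nestedSum-*ˡ (suc k) N a h = trans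
      (sum1-cong N (λ m _ _ → trans (*-congˡ (nestedSum-*ˡ k m a h)) (x∙yz≈y∙xz _ _ _)))
      (sym (sum1-*ˡ N a _))

    nestedSum-sum0 : ∀ k N M (G : ℕ → ℕ → Carrier) →
      nestedSum (λ n → sum0 M (λ r → G r n)) k N ≈ sum0 M (λ r → nestedSum (G r) k N)
    nestedSum-sum0 zero    N M G = refl
    nestedSum-sum0 (suc k) N M G = trans
      (sum1-cong N (λ m _ _ → trans (*-congˡ (nestedSum-sum0 k m M G)) (sum0-*ˡ M _ _)))
      (sum1-sum0-comm N M _)

    -- Set to 0 for n < r, where the truncated n ∸ r would otherwise give a nonzero junk value.
    kernel : ℕ → ℕ → Carrier
    kernel r n with r ≤? n
    ... | yes _ = poch n * poch n / (poch (n ∸ℕ r) * poch (n +ℕ r))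
    ... | no  _ = 0#

    kernel-≤ : ∀ {r n} → r ≤ n → kernel r n ≈ poch n * poch n / (poch (n ∸ℕ r) * poch (n +ℕ r))
    kernel-≤ {r} {n} r≤n with r ≤? n
    ... | yes _   = refl
    ... | no  r≰n = contradiction r≤n r≰n

    kernel-> : ∀ {r n} → n < r → kernel r n ≈ 0#
    kernel-> {r} {n} n<r with r ≤? n
    ... | yes r≤n = contradiction r≤n (ℕₚ.<⇒≱ n<r)
    ... | no  _   = refl

    kernel-0 : ∀ n → kernel 0 n ≈ 1#
    kernel-0 n = trans (kernel-≤ {n = n} z≤n) (⁻¹-inverse-n+0 n)
      where
      ⁻¹-inverse-n+0 : ∀ n → poch n * poch n / (poch n * poch (n +ℕ 0)) ≈ 1#
      ⁻¹-inverse-n+0 n rewrite ℕₚ.+-identityʳ n =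
        ⁻¹-inverse _ (*-nonZero (poch-nonZero n) (poch-nonZero n))

    kernel-suc : ∀ j r → let N = j +ℕ r in
      kernel r (suc N) ≈ kernel r N * ((1# - pow q (suc N)) * (1# - pow q (suc N)))
                                    / ((1# - pow q (suc j)) * (1# - pow q (suc (N +ℕ r))))
    kernel-suc j r = begin
      kernel r (suc N)
        ≈⟨ kernel-≤ (m≤n⇒m≤1+n r≤N) ⟩
      poch (suc N) * poch (suc N) / (poch (suc N ∸ℕ r) * poch (suc N +ℕ r))
        ≡⟨ ≡.cong (λ i → poch (suc N) * poch (suc N) / (poch i * poch (suc N +ℕ r))) (m+n∸n≡m (suc j) r) ⟩
      poch N * a * (poch N * a) / (poch j * b * (poch (N +ℕ r) * e))
        ≈⟨ *-congˡ (⁻¹-cong (*-nonZero (poch-nonZero (suc j)) (poch-nonZero (suc (N +ℕ r))))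
                            (interchange _ _ _ _)) ⟩
      poch N * a * (poch N * a) / (poch j * poch (N +ℕ r) * (b * e))
        ≈⟨ *-congˡ (⁻¹-distrib-* (*-nonZero (poch-nonZero j) (poch-nonZero (N +ℕ r)))
                                 (*-nonZero (1-q^suc≉0 j) (1-q^suc≉0 (N +ℕ r)))) ⟩
      poch N * a * (poch N * a) * ((poch j * poch (N +ℕ r)) ⁻¹ * (b * e) ⁻¹)
        ≈⟨ solve 4 (λ P a Q B → P :* a :* (P :* a) :* (Q :* B) := P :* P :* Q :* (a :* a) :* B) refl _ _ _ _ ⟩
      poch N * poch N / (poch j * poch (N +ℕ r)) * (a * a) / (b * e)
        ≡⟨ ≡.cong (λ i → poch N * poch N / (poch i * poch (N +ℕ r)) * (a * a) / (b * e)) (m+n∸n≡m j r) ⟨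
      poch N * poch N / (poch (N ∸ℕ r) * poch (N +ℕ r)) * (a * a) / (b * e)
        ≈⟨ *-congʳ (*-congʳ (kernel-≤ r≤N)) ⟨
      kernel r N * (a * a) / (b * e) ∎
      where
      N : ℕ
      N = j +ℕ r
      r≤N : r ≤ N
      r≤N = m≤n+m r j
      a : Carrier
      a = 1# - pow q (suc N)
      b : Carrier
      b = 1# - pow q (suc j)
      e : Carrier
      e = 1# - pow q (suc (N +ℕ r))

    weight-kernel-step-+ : ∀ j {r} → 1 ≤ r → let N = j +ℕ r in
      weight r * kernel r N + weight (suc N) * kernel r (suc N) ≈ weight r * kernel r (suc N)
    weight-kernel-step-+ j {suc r} _ = begin
      weight (suc r) * K + weight (suc N) * kernel (suc r) (suc N)
        ≈⟨ +-congˡ (*-congˡ (kernel-suc j (suc r))) ⟩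
      weight (suc r) * K + weight (suc N) * (K * (a * a) / (b * e))
        ≈⟨ telescoping-fraction _ _ K (*-nonZero (1-q^suc≉0 r) (1-q^suc≉0 r))
             (*-nonZero (1-q^suc≉0 N) (1-q^suc≉0 N)) (*-nonZero (1-q^suc≉0 j) (1-q^suc≉0 (N +ℕ suc r)))
             (telescoping-polynomial (pow-homo-* q (suc j) (suc r))
               (trans (pow-homo-* q (suc N) (suc r)) (*-congʳ (pow-homo-* q (suc j) (suc r))))) ⟩
      weight (suc r) * (K * (a * a) / (b * e))
        ≈⟨ *-congˡ (kernel-suc j (suc r)) ⟨
      weight (suc r) * kernel (suc r) (suc N) ∎
      where
      N : ℕ
      N = j +ℕ suc r
      K : Carrier
      K = kernel (suc r) N
      a : Carrier
      a = 1# - pow q (suc N)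
      b : Carrier
      b = 1# - pow q (suc j)
      e : Carrier
      e = 1# - pow q (suc (N +ℕ suc r))

    weight-kernel-step : ∀ {r} → 1 ≤ r → ∀ N →
      weight r * kernel r N + weight (suc N) * kernel r (suc N) ≈ weight r * kernel r (suc N)
    weight-kernel-step {r} 1≤r N with ℕₚ.≤-<-connex r N
    weight-kernel-step {r} 1≤r N | inj₁ r≤N with N ∸ℕ r | m∸n+n≡m r≤N
    ...   | j | ≡.refl = weight-kernel-step-+ j 1≤r
    weight-kernel-step {r} 1≤r N | inj₂ N<r with m≤n⇒m<n∨m≡n N<r
    ...   | inj₁ N+1<r = begin
      weight r * kernel r N + weight (suc N) * kernel r (suc N)
        ≈⟨ +-cong (*-congˡ (kernel-> N<r)) (*-congˡ (kernel-> N+1<r)) ⟩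
      weight r * 0# + weight (suc N) * 0#
        ≈⟨ trans (+-cong (zeroʳ _) (zeroʳ _)) (+-identityʳ 0#) ⟩
      0#
        ≈⟨ trans (*-congˡ (kernel-> N+1<r)) (zeroʳ _) ⟨
      weight r * kernel r (suc N) ∎
    ...   | inj₂ ≡.refl = trans (+-congʳ (trans (*-congˡ (kernel-> N<r)) (zeroʳ _))) (+-identityˡ _)

    kernel-telescopes : ∀ {r} → 1 ≤ r → ∀ N →
      sum1 N (λ n → weight n * kernel r n) ≈ weight r * kernel r N
    kernel-telescopes 1≤r zero    = sym (trans (*-congˡ (kernel-> 1≤r)) (zeroʳ _))
    kernel-telescopes 1≤r (suc N) = trans (+-congʳ (kernel-telescopes 1≤r N)) (weight-kernel-step 1≤r N)

    nestedSum-kernel : ∀ {r} → 1 ≤ r → ∀ k N → nestedSum (kernel r) k N ≈ pow (weight r) k * kernel r N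
    nestedSum-kernel 1≤r zero    N = sym (*-identityˡ _)
    nestedSum-kernel {r} 1≤r (suc k) N = begin
      sum1 N (λ m → weight m * nestedSum (kernel r) k m)
        ≈⟨ sum1-cong N (λ m _ _ → trans (*-congˡ (nestedSum-kernel 1≤r k m)) (x∙yz≈y∙xz _ _ _)) ⟩
      sum1 N (λ m → pow (weight r) k * (weight m * kernel r m))
        ≈⟨ sum1-*ˡ N _ _ ⟨
      pow (weight r) k * sum1 N (λ m → weight m * kernel r m)
        ≈⟨ *-congˡ (kernel-telescopes 1≤r N) ⟩
      pow (weight r) k * (weight r * kernel r N)
        ≈⟨ x∙yz≈yx∙z _ _ _ ⟩
      pow (weight r) (suc k) * kernel r N ∎

    pow-weight : ∀ {r} → 1 ≤ r → ∀ k → pow (weight r) k ≈ pow q (k *ℕ r) / pow (1# - pow q r) (2 *ℕ k)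
    pow-weight {suc r} _ k = begin
      pow (pow q (suc r) / (s * s)) k
        ≈⟨ pow-/ (pow q (suc r)) k s²≉0 ⟩
      pow (pow q (suc r)) k / pow (s * s) k
        ≈⟨ *-cong (pow-assocʳ q (suc r) k) (⁻¹-cong (pow-nonZero k s²≉0) (pow-square s k)) ⟩
      pow q (suc r *ℕ k) / pow s (2 *ℕ k)
        ≡⟨ ≡.cong (λ i → pow q i / pow s (2 *ℕ k)) (ℕₚ.*-comm (suc r) k) ⟩
      pow q (k *ℕ suc r) / pow s (2 *ℕ k) ∎
      where
      s : Carrier
      s = 1# - pow q (suc r)
      s²≉0 : NonZero (s * s)
      s²≉0 = *-nonZero (1-q^suc≉0 r) (1-q^suc≉0 r)

    scaled-nestedSum-kernel : ∀ {r N} a k → 1 ≤ r → r ≤ N →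
      a * nestedSum (kernel r) k N
        ≈ poch N * poch N / (poch (N ∸ℕ r) * poch (N +ℕ r)) * (pow q (k *ℕ r) * a / pow (1# - pow q r) (2 *ℕ k))
    scaled-nestedSum-kernel {r} {N} a k 1≤r r≤N = begin
      a * nestedSum (kernel r) k N
        ≈⟨ *-congˡ (nestedSum-kernel 1≤r k N) ⟩
      a * (pow (weight r) k * kernel r N)
        ≈⟨ *-congˡ (*-cong (pow-weight 1≤r k) (kernel-≤ r≤N)) ⟩
      a * (pow q (k *ℕ r) / pow (1# - pow q r) (2 *ℕ k) * (poch N * poch N / (poch (N ∸ℕ r) * poch (N +ℕ r))))
        ≈⟨ solve 4 (λ a Q S P → a :* (Q :* S :* P) := P :* (Q :* a :* S)) refl _ _ _ _ ⟩
      poch N * poch N / (poch (N ∸ℕ r) * poch (N +ℕ r)) * (pow q (k *ℕ r) * a / pow (1# - pow q r) (2 *ℕ k)) ∎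

    bailey-expansion : ∀ {α β} → IsBaileyPair 1# q α β → ∀ {n N} → n ≤ N →
      poch n * poch n * β n ≈ sum0 N (λ r → α r * kernel r n)
    bailey-expansion {α} {β} bailey {n} {N} n≤N = begin
      poch n * poch n * β n
        ≈⟨ *-congˡ (bailey n) ⟩
      poch n * poch n * sum0 n (λ r → α r / (poch (n ∸ℕ r) * qPoch (1# * q) q (n +ℕ r)))
        ≈⟨ sum0-*ˡ n _ _ ⟩
      sum0 n (λ r → poch n * poch n * (α r / (poch (n ∸ℕ r) * qPoch (1# * q) q (n +ℕ r))))
        ≈⟨ sum0-cong n summand ⟩
      sum0 n (λ r → α r * kernel r n)
        ≈⟨ sum0-truncate _ n≤N (λ r n<r → trans (*-congˡ (kernel-> n<r)) (zeroʳ (α r))) ⟨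
      sum0 N (λ r → α r * kernel r n) ∎
      where
      summand : ∀ r → r ≤ n →
        poch n * poch n * (α r / (poch (n ∸ℕ r) * qPoch (1# * q) q (n +ℕ r))) ≈ α r * kernel r n
      summand r r≤n = begin
        poch n * poch n * (α r / (poch (n ∸ℕ r) * qPoch (1# * q) q (n +ℕ r)))
          ≈⟨ *-congˡ (*-congˡ (⁻¹-cong (*-nonZero (poch-nonZero (n ∸ℕ r)) (poch-nonZero (n +ℕ r)))
                                        (*-congˡ (qPoch-congˡ (n +ℕ r) (sym (*-identityˡ q)))))) ⟨
        poch n * poch n * (α r / (poch (n ∸ℕ r) * poch (n +ℕ r)))
          ≈⟨ x∙yz≈y∙xz _ _ _ ⟩
        α r * (poch n * poch n / (poch (n ∸ℕ r) * poch (n +ℕ r)))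
          ≈⟨ *-congˡ (kernel-≤ r≤n) ⟨
        α r * kernel r n ∎

proposition5p1 : {c ℓ : Level} (F : Field c ℓ) →
  let open Field F
      open FieldOps F
  in (q : Carrier) →
     (∀ m → ¬ (1# - pow q (suc m) ≈ 0#)) →
     (α β : ℕ → Carrier) →
     IsBaileyPair 1# q α β →
     α 0 ≈ 1# → β 0 ≈ 1# →
     (N k : ℕ) → 1 ≤ N → 1 ≤ k →
     chainSum k N (λ v → qPoch q q (lastOr0 v) * qPoch q q (lastOr0 v) * pow q (vsum v) * β (lastOr0 v) / sqDen q v)
       ≈ chainSum k N (λ v → pow q (vsum v) / sqDen q v)
         + sum1 N (λ r → (qPoch q q N * qPoch q q N) / (qPoch q q (N ∸ℕ r) * qPoch q q (N +ℕ r))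
                           * (pow q (k *ℕ r) * α r / pow (1# - pow q r) (2 *ℕ k)))
proposition5p1 F q 1-q^suc≉0 α β bailey α₀≈1 _ N (suc k) _ _ = begin
  chainSum (suc k) N (λ v → poch (lastOr0 v) * poch (lastOr0 v) * pow q (vsum v) * β (lastOr0 v) / sqDen q v)
    ≈⟨ chainSum≈nestedSum k N (λ n → poch n * poch n * β n) _
         (λ v → trans (*-congʳ (xy∙z≈xz∙y _ _ _)) (*-assoc _ _ _)) ⟩
  nestedSum (λ n → poch n * poch n * β n) (suc k) N
    ≈⟨ nestedSum-cong (suc k) N (λ n → bailey-expansion bailey) ⟩
  nestedSum (λ n → sum0 N (λ r → α r * kernel r n)) (suc k) N
    ≈⟨ nestedSum-sum0 (suc k) N N _ ⟩
  sum0 N (λ r → nestedSum (λ n → α r * kernel r n) (suc k) N)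
    ≈⟨ sum0-cong N (λ r _ → nestedSum-*ˡ (suc k) N (α r) (kernel r)) ⟩
  sum0 N (λ r → α r * nestedSum (kernel r) (suc k) N)
    ≈⟨ sum0≈head+sum1 N _ ⟩
  α 0 * nestedSum (kernel 0) (suc k) N + sum1 N (λ r → α r * nestedSum (kernel r) (suc k) N)
    ≈⟨ +-cong (trans (*-cong α₀≈1 (nestedSum-cong (suc k) N (λ n _ → kernel-0 n))) (*-identityˡ _))
              (sum1-cong N (λ r 1≤r r≤N → scaled-nestedSum-kernel (α r) (suc k) 1≤r r≤N)) ⟩
  nestedSum (λ _ → 1#) (suc k) N
    + sum1 N (λ r → poch N * poch N / (poch (N ∸ℕ r) * poch (N +ℕ r))
                      * (pow q (suc k *ℕ r) * α r / pow (1# - pow q r) (2 *ℕ suc k)))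
    ≈⟨ +-congʳ (chainSum≈nestedSum k N (λ _ → 1#) _ (λ v → sym (*-identityˡ _))) ⟨
  chainSum (suc k) N (λ v → pow q (vsum v) / sqDen q v)
    + sum1 N (λ r → poch N * poch N / (poch (N ∸ℕ r) * poch (N +ℕ r))
                      * (pow q (suc k *ℕ r) * α r / pow (1# - pow q r) (2 *ℕ suc k))) ∎
  where
  open Field F
  open FieldOps F
  open SumProperties F
  open BaileyChain.WithBase F q 1-q^suc≉0
  open import Relation.Binary.Reasoning.Setoid setoid
  open import Algebra.Properties.CommutativeSemigroup *-commutativeSemigroup using (xy∙z≈xz∙y)
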